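{- Let $t$ be a positive integer. If a graph $G$ has a wide coloring using $t$ colors, then $\psi(G)\le\lfloor t/2\rfloor+2$.
   Context: A vertex coloring of a graph is wide if the two end vertices of every walk of length $5$ receive different colors. The local chromatic number is $\psi(G)=\min_c\max_{v\in V(G)}|\{c(u):u\in N(v)\}|+1$, minimum over all proper colorings $c$ of $G$, where $N(v)$ is the neighbourhood of $v$. -}

module Defs where

open import Data.Nat using (ℕ; zero; suc; _+_; _≤_; _/_)
open import Data.Nat.Properties using () renaming (_≟_ to _≟ℕ_)
open import Data.Fin using (Fin)
open import Data.Bool using (Bool; true; false; T)
open import Data.List using (List; map; filter; length; deduplicate; allFin)
open import Data.Bool using (T?)
open import Data.Product using (Σ; _×_; ∃)
open import Relation.Binary.PropositionalEquality using (_≡_)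
open import Relation.Nullary using (¬_)

record Graph (n : ℕ) : Set where
  field
    adj   : Fin n → Fin n → Bool
    sym   : ∀ u v → adj u v ≡ adj v u
    irrefl : ∀ v → adj v v ≡ false

open Graph public

Adj : ∀ {n} → Graph n → Fin n → Fin n → Set
Adj G u v = T (adj G u v)

data Walk {n : ℕ} (G : Graph n) : Fin n → Fin n → ℕ → Set where
  here : ∀ v → Walk G v v zero
  step : ∀ {u w v k} → Adj G u w → Walk G w v k → Walk G u v (suc k)

Wide : ∀ {n} {C : Set} → Graph n → (Fin n → C) → Set
Wide G c = ∀ u v → Walk G u v 5 → ¬ (c u ≡ c v)

Proper : ∀ {n} {C : Set} → Graph n → (Fin n → C) → Set
Proper G c = ∀ u v → Adj G u v → ¬ (c u ≡ c v)

nbhd : ∀ {n} → Graph n → Fin n → List (Fin n)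
nbhd G v = filter (λ u → T? (adj G v u)) (allFin _)

numNbColors : ∀ {n} → Graph n → (Fin n → ℕ) → Fin n → ℕ
numNbColors G c v = length (deduplicate _≟ℕ_ (map c (nbhd G v)))

-- ψ(G) ≤ k, i.e. min over proper colorings c of max_v |c(N(v))| + 1 is at most k:
-- some proper coloring c has |c(N(v))| + 1 ≤ k for every v.
LocalChromaticAtMost : ∀ {n} → Graph n → ℕ → Set
LocalChromaticAtMost G k =
  Σ (Fin _ → ℕ) λ c → Proper G c × (∀ v → numNbColors G c v + 1 ≤ k)

-- Call a vertex rich if its neighbourhood sees more than ⌊t/2⌋ colours. If x ~ x' and y, y' are
-- rich neighbours of x and x', every colour seen by y differs from every colour seen by y', since
-- a − y − x − x' − y' − b is a walk of length 5; so y and y' together see more than t colours,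
-- which is impossible. Hence the vertices with a rich neighbour are independent. Give them all a
-- new colour 0 and keep c, shifted by one, elsewhere (wide colourings are proper). A rich vertex
-- then sees only colour 0, and any other vertex sees at most ⌊t/2⌋ old colours plus 0.
module Submission where

open import Defs
open import Data.Nat using (ℕ; suc; _≤_; _<_; _+_; _*_; _/_; _%_; _<?_; z≤n; s≤s)
open import Data.Nat.Properties
  using (_≟_; ≤-trans; ≤-reflexive; <⇒≱; ≮⇒≥; +-mono-≤; +-monoˡ-≤; +-monoˡ-<; +-suc; suc-injective; module ≤-Reasoning)
open import Data.Nat.DivMod using (m≡m%n+[m/n]*n; m%n<n)
open import Data.Nat.Tactic.RingSolver using (solve-∀)
open import Data.Fin using (Fin; toℕ)
open import Data.Fin.Properties using (toℕ-injective; toℕ<n)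
open import Data.Bool using (T; T?)
open import Data.List using (List; []; _∷_; [_]; _++_; map; length; deduplicate; allFin; upTo)
open import Data.List.Properties using (length-++; length-++-sucʳ; length-upTo; length-map)
open import Data.List.Membership.Propositional using (_∈_)
open import Data.List.Membership.Propositional.Properties
  using (∈-∃++; ∈-++⁻; ∈-++⁺ˡ; ∈-++⁺ʳ; ∈-map⁺; ∈-map⁻; ∈-filter⁺; ∈-filter⁻; ∈-allFin; ∈-upTo⁺;
         ∈-deduplicate⁺; ∈-deduplicate⁻)
open import Data.List.Relation.Binary.Subset.Propositional using (_⊆_)
open import Data.List.Relation.Binary.Disjoint.Propositional using (Disjoint)
open import Data.List.Relation.Unary.All as All using ()
open import Data.List.Relation.Unary.Any as Any using (Any; here; there; any?; satisfied)
open import Data.List.Relation.Unary.Unique.Propositional using (Unique; _∷_)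
open import Data.List.Relation.Unary.Unique.Propositional.Properties using (++⁺)
import Data.List.Relation.Unary.Unique.DecPropositional.Properties as UniqueDec
open import Data.Product using (_×_; _,_; proj₂; ∃)
open import Data.Sum using (inj₁; inj₂)
open import Data.Empty using (⊥; ⊥-elim)
open import Relation.Binary.Definitions using (DecidableEquality)
open import Relation.Nullary using (Dec; yes; no)
open import Relation.Nullary.Decidable using (_×-dec_)
open import Relation.Binary.PropositionalEquality using (_≡_; _≢_; refl; cong; subst)
import Relation.Binary.PropositionalEquality as ≡
open import Function using (_∘′_)

module _ {a} {A : Set a} where

  ∈-++-skip : ∀ {x z} (as bs : List A) → z ≢ x → z ∈ as ++ x ∷ bs → z ∈ as ++ bs
  ∈-++-skip as bs z≢x z∈ with ∈-++⁻ as z∈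
  ... | inj₁ z∈as         = ∈-++⁺ˡ z∈as
  ... | inj₂ (here z≡x)   = ⊥-elim (z≢x z≡x)
  ... | inj₂ (there z∈bs) = ∈-++⁺ʳ as z∈bs

  Unique-⊆⇒length≤ : ∀ {xs ys : List A} → Unique xs → xs ⊆ ys → length xs ≤ length ys
  Unique-⊆⇒length≤ {[]}     _              _ = z≤n
  Unique-⊆⇒length≤ {x ∷ xs} (x∉xs ∷ uniq) xs⊆ys
    with as , bs , refl ← ∈-∃++ (xs⊆ys (here refl)) = begin
      suc (length xs)          ≤⟨ s≤s (Unique-⊆⇒length≤ uniq xs⊆as++bs) ⟩
      suc (length (as ++ bs))  ≡⟨ length-++-sucʳ as x bs ⟨
      length (as ++ x ∷ bs)    ∎
    where
    open ≤-Reasoning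
    xs⊆as++bs : xs ⊆ as ++ bs
    xs⊆as++bs z∈xs = ∈-++-skip as bs (λ z≡x → All.lookup x∉xs z∈xs (≡.sym z≡x)) (xs⊆ys (there z∈xs))

  length-deduplicate≤ : (_≟A_ : DecidableEquality A) {xs ys : List A} →
                        xs ⊆ ys → length (deduplicate _≟A_ xs) ≤ length ys
  length-deduplicate≤ _≟A_ {xs} xs⊆ys =
    Unique-⊆⇒length≤ (UniqueDec.deduplicate-! _≟A_ xs) (xs⊆ys ∘′ ∈-deduplicate⁻ _≟A_ xs)

m/2<n⇒m/2<o⇒m<n+o : ∀ m {n o} → m / 2 < n → m / 2 < o → m < n + o
m/2<n⇒m/2<o⇒m<n+o m {n} {o} h<n h<o = begin-strict
  m                     ≡⟨ m≡m%n+[m/n]*n m 2 ⟩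
  m % 2 + h * 2         <⟨ +-monoˡ-< (h * 2) (m%n<n m 2) ⟩
  2 + h * 2             ≡⟨ 2+k*2≡1+k+1+k h ⟩
  suc h + suc h         ≤⟨ +-mono-≤ h<n h<o ⟩
  n + o                 ∎
  where
  open ≤-Reasoning
  h : ℕ
  h = m / 2
  2+k*2≡1+k+1+k : ∀ k → 2 + k * 2 ≡ suc k + suc k
  2+k*2≡1+k+1+k = solve-∀

module _ {n} (G : Graph n) where

  Adj-sym : ∀ {u v} → Adj G u v → Adj G v u
  Adj-sym {u} {v} = subst T (Graph.sym G u v)

  ∈-nbhd⁺ : ∀ {v u} → Adj G v u → u ∈ nbhd G v
  ∈-nbhd⁺ {v} {u} = ∈-filter⁺ (λ w → T? (adj G v w)) (∈-allFin u)

  ∈-nbhd⁻ : ∀ {v u} → u ∈ nbhd G v → Adj G v u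
  ∈-nbhd⁻ {v} = proj₂ ∘′ ∈-filter⁻ (λ w → T? (adj G v w)) {xs = allFin n}

  nbColours : (Fin n → ℕ) → Fin n → List ℕ
  nbColours f v = deduplicate _≟_ (map f (nbhd G v))

  ∈-nbColours⁺ : ∀ f {v u} → Adj G v u → f u ∈ nbColours f v
  ∈-nbColours⁺ f = ∈-deduplicate⁺ _≟_ ∘′ ∈-map⁺ f ∘′ ∈-nbhd⁺

  ∈-nbColours⁻ : ∀ f {v k} → k ∈ nbColours f v → ∃ λ u → Adj G v u × k ≡ f u
  ∈-nbColours⁻ f {v} k∈ with u , u∈ , k≡fu ← ∈-map⁻ f (∈-deduplicate⁻ _≟_ (map f (nbhd G v)) k∈) =
    u , ∈-nbhd⁻ u∈ , k≡fu

  numNbColors≤ : ∀ f v {ks} → (∀ {u} → Adj G v u → f u ∈ ks) → numNbColors G f v ≤ length ks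
  numNbColors≤ f v nb⊆ks = length-deduplicate≤ _≟_ λ k∈ →
    let u , u∈ , k≡fu = ∈-map⁻ f k∈ in subst (_∈ _) (≡.sym k≡fu) (nb⊆ks (∈-nbhd⁻ u∈))

  Wide⇒Proper : ∀ {C : Set} {c : Fin n → C} → Wide G c → Proper G c
  Wide⇒Proper wide u v uv = wide u v (step uv (step vu (step uv (step vu (step uv (here v))))))
    where
    vu : Adj G v u
    vu = Adj-sym uv

module WideColouring {t n} (G : Graph n) (c : Fin n → Fin t) (wide : Wide G c) where

  colour : Fin n → ℕ
  colour = toℕ ∘′ c

  nbColours⊆upTo : ∀ v → nbColours G colour v ⊆ upTo t
  nbColours⊆upTo v k∈ with u , _ , refl ← ∈-nbColours⁻ G colour k∈ = ∈-upTo⁺ (toℕ<n (c u))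

  nbColours-disjoint : ∀ {y x x' y'} → Adj G y x → Adj G x x' → Adj G x' y' →
                       Disjoint (nbColours G colour y) (nbColours G colour y')
  nbColours-disjoint yx xx' x'y' (k∈y , k∈y')
    with a , ya , refl ← ∈-nbColours⁻ G colour k∈y
       | b , y'b , k≡b ← ∈-nbColours⁻ G colour k∈y' =
    wide a b (step (Adj-sym G ya) (step yx (step xx' (step x'y' (step y'b (here b))))))
         (toℕ-injective k≡b)

  numNbColors-+-≤ : ∀ {y x x' y'} → Adj G y x → Adj G x x' → Adj G x' y' →
                    numNbColors G colour y + numNbColors G colour y' ≤ t
  numNbColors-+-≤ {y} {y' = y'} yx xx' x'y' = begin
    numNbColors G colour y + numNbColors G colour y'  ≡⟨ length-++ (nbColours G colour y) ⟨
    length (nbColours G colour y ++ nbColours G colour y')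
      ≤⟨ Unique-⊆⇒length≤ (++⁺ (UniqueDec.deduplicate-! _≟_ _) (UniqueDec.deduplicate-! _≟_ _)
                                 (nbColours-disjoint yx xx' x'y')) both⊆upTo ⟩
    length (upTo t)                                   ≡⟨ length-upTo t ⟩
    t                                                 ∎
    where
    open ≤-Reasoning
    both⊆upTo : nbColours G colour y ++ nbColours G colour y' ⊆ upTo t
    both⊆upTo k∈ with ∈-++⁻ (nbColours G colour y) k∈
    ... | inj₁ k∈y  = nbColours⊆upTo y k∈y
    ... | inj₂ k∈y' = nbColours⊆upTo y' k∈y'

  Rich : Fin n → Set
  Rich y = t / 2 < numNbColors G colour y

  rich? : ∀ y → Dec (Rich y)
  rich? y = t / 2 <? numNbColors G colour y

  NearRich : Fin n → Set
  NearRich x = Any (λ y → Adj G x y × Rich y) (allFin n)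

  nearRich? : ∀ x → Dec (NearRich x)
  nearRich? x = any? (λ y → T? (adj G x y) ×-dec rich? y) (allFin n)

  nearRich⁺ : ∀ {x y} → Adj G x y → Rich y → NearRich x
  nearRich⁺ {y = y} xy rich = Any.map (λ { refl → xy , rich }) (∈-allFin y)

  nearRich-independent : ∀ {x x'} → Adj G x x' → NearRich x → NearRich x' → ⊥
  nearRich-independent xx' near near'
    with y , xy , rich ← satisfied near | y' , x'y' , rich' ← satisfied near' =
    <⇒≱ (m/2<n⇒m/2<o⇒m<n+o t rich rich') (numNbColors-+-≤ (Adj-sym G xy) xx' x'y')

  recolour : ∀ {x} → Dec (NearRich x) → ℕ
  recolour     (yes _) = 0
  recolour {x} (no _)  = suc (colour x)

  colour′ : Fin n → ℕ
  colour′ x = recolour (nearRich? x)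

  colour′-proper : Proper G colour′
  colour′-proper u v uv with nearRich? u | nearRich? v
  ... | yes near | yes near′ = λ _ → nearRich-independent uv near near′
  ... | yes _    | no _      = λ ()
  ... | no _     | yes _     = λ ()
  ... | no _     | no _      = Wide⇒Proper G wide u v uv ∘′ toℕ-injective ∘′ suc-injective

  colour′-nearRich : ∀ {x} → NearRich x → colour′ x ≡ 0
  colour′-nearRich {x} near with nearRich? x
  ... | yes _   = refl
  ... | no far  = ⊥-elim (far near)

  colour′∈ : ∀ v {u} → Adj G v u → colour′ u ∈ 0 ∷ map suc (nbColours G colour v)
  colour′∈ v {u} vu with nearRich? u
  ... | yes _ = here refl
  ... | no _  = there (∈-map⁺ suc (∈-nbColours⁺ G colour vu))

  numNbColors-colour′≤ : ∀ v → numNbColors G colour′ v ≤ suc (t / 2)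
  numNbColors-colour′≤ v with rich? v
  ... | yes rich = ≤-trans (numNbColors≤ G colour′ v {[ 0 ]} λ vu →
                             here (colour′-nearRich (nearRich⁺ (Adj-sym G vu) rich)))
                           (s≤s z≤n)
  ... | no poor  = begin
    numNbColors G colour′ v                            ≤⟨ numNbColors≤ G colour′ v (colour′∈ v) ⟩
    suc (length (map suc (nbColours G colour v)))      ≡⟨ cong suc (length-map suc (nbColours G colour v)) ⟩
    suc (numNbColors G colour v)                       ≤⟨ s≤s (≮⇒≥ poor) ⟩
    suc (t / 2)                                        ∎
    where open ≤-Reasoning

lemma4p2 : (t : ℕ) → 1 ≤ t → (n : ℕ) → (G : Graph n) → (c : Fin n → Fin t) →
    Wide G c → LocalChromaticAtMost G (t / 2 + 2)
lemma4p2 t _ n G c wide =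
  colour′ , colour′-proper ,
  λ v → ≤-trans (+-monoˡ-≤ 1 (numNbColors-colour′≤ v)) (≤-reflexive (≡.sym (+-suc (t / 2) 1)))
  where open WideColouring G c wide
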